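{- Let $f=f_1f_2\cdots f_n\in F_n$, let $\sigma=\phi(f)$, and let $i\in[n]$. Then: (1) $i\in\mathrm{ImRp}(f)$ if and only if $i\in\mathrm{AX}(\sigma)$; (2) $f_i=\sigma(i)$ if and only if $i\in\mathrm{AX}(\sigma)$.
   Context: $[n]=\{1,\dots,n\}$, $\mathfrak{S}_n$ is the symmetric group on $[n]$, and products of permutations are composed with the leftmost factor acting first: $(\alpha\beta)(x)=\beta(\alpha(x))$. A function $f:[n]\to[n]$ is subexceedant if $1\le f(i)\le i$ for all $i$, written as the word $f_1\cdots f_n$; $F_n$ is the set of subexceedant functions on $[n]$. $\phi:F_n\to\mathfrak{S}_n$ is defined by $\phi(f)=(1,f_1)(2,f_2)\cdots(n,f_n)$ (with $(i,i)$ the identity). $\mathrm{ImRp}(f)$ is the set of positions of rightmost occurrences of the values of $f$, i.e. $\{i\in[n]: f_j\ne f_i \text{ for all } j>i\}$. For $\sigma\in\mathfrak{S}_n$, $\mathrm{AX}(\sigma)=\{i\in[n]:\sigma(i)\le i\}$ is the set of anti-exceedances of $\sigma$. -}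

module Defs where

open import Data.Nat using (_≤_)
open import Data.Fin using (Fin; toℕ; _<_)
import Data.Fin as Fin
open import Data.Fin.Permutation using (Permutation′; transpose; _∘ₚ_; id; _⟨$⟩ʳ_)
open import Data.List using (foldr; allFin)
open import Relation.Binary.PropositionalEquality using (_≢_)

-- Convention: [n] = {1,…,n} is modelled by Fin n = {0,…,n-1} (shift by one).
-- A word f₁⋯fₙ is a function f : Fin n → Fin n.

Subexceedant : ∀ {n} → (Fin n → Fin n) → Set
Subexceedant f = ∀ i → toℕ (f i) ≤ toℕ i

-- φ(f) = (1,f₁)(2,f₂)⋯(n,fₙ), leftmost factor acts first.
-- In the stdlib, (π₁ ∘ₚ π₂) ⟨$⟩ʳ x = π₂ ⟨$⟩ʳ (π₁ ⟨$⟩ʳ x), i.e. π₁ acts first,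
-- matching the paper's convention. transpose i i is the identity.
φ : ∀ {n} → (Fin n → Fin n) → Permutation′ n
φ {n} f = foldr (λ i π → transpose i (f i) ∘ₚ π) id (allFin n)

ImRp : ∀ {n} → (Fin n → Fin n) → Fin n → Set
ImRp f i = ∀ j → i < j → f j ≢ f i

AX : ∀ {n} → Permutation′ n → Fin n → Set
AX σ i = toℕ (σ ⟨$⟩ʳ i) ≤ toℕ i

{-# OPTIONS --safe #-}
module Submission where

-- Push i through the transpositions (1,f₁)⋯(n,fₙ). Those with index k < i fix i, since
-- f_k ≤ k < i, and then (i,f_i) sends i to f_i ≤ i. A later transposition (k,f_k), k > i,
-- moves the current value only if it equals f_k, and then moves it to k. So σ(i) = f_i when
-- no k > i has f_k = f_i, and otherwise σ(i) is one of those later indices k > i.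

open import Defs
open import Data.Nat using (ℕ; _≤_)
open import Data.Nat.Properties using (≤-<-trans; <-asym; <⇒≱)
open import Data.Fin using (Fin; toℕ; _<_; _≟_)
open import Data.Fin.Properties using (<⇒≢)
open import Data.Fin.Permutation using (_⟨$⟩ʳ_; transpose; id; _∘ₚ_)
import Data.Fin.Permutation.Components as PC
open import Data.Product using (_×_; _,_; ∃₂)
open import Data.Sum using (inj₁; inj₂)
open import Data.List using (List; []; _∷_; _++_; foldr; allFin)
open import Data.List.Relation.Unary.All using (All; []; _∷_)
import Data.List.Relation.Unary.All as All
import Data.List.Relation.Unary.All.Properties as All
open import Data.List.Relation.Unary.Any using (Any; here; there)
open import Data.List.Relation.Unary.AllPairs using (AllPairs; []; _∷_)
import Data.List.Relation.Unary.AllPairs as AllPairs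
import Data.List.Relation.Unary.AllPairs.Properties as AllPairs
open import Data.List.Relation.Unary.Unique.Propositional using (Unique)
open import Data.List.Membership.Propositional using (_∈_; lose)
open import Data.List.Membership.Propositional.Properties using (∈-allFin; ∈-∃++; ∈-++⁻)
open import Function using (_∘_)
open import Function.Bundles using (_⇔_; mk⇔)
open import Relation.Binary.Core using (Rel)
open import Relation.Binary.PropositionalEquality using (_≡_; refl; sym; trans; cong; subst; _≢_; module ≡-Reasoning)
open import Relation.Nullary using (yes; no; contradiction)
open import Relation.Nullary.Decidable using (dec-true; dec-false)

module _ {n : ℕ} {i j : Fin n} where

  transpose-≢ : ∀ {x} → x ≢ i → x ≢ j → PC.transpose i j x ≡ x
  transpose-≢ {x} x≢i x≢j rewrite dec-false (x ≟ i) x≢i | dec-false (x ≟ j) x≢j = refl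

  transpose-left : PC.transpose i j i ≡ j
  transpose-left rewrite dec-true (i ≟ i) refl = refl

  transpose-right : j ≢ i → PC.transpose i j j ≡ i
  transpose-right j≢i rewrite dec-false (j ≟ i) j≢i | dec-true (j ≟ j) refl = refl

module _ {a r} {A : Set a} {R : Rel A r} where

  AllPairs-++-∷⁻ : ∀ pre {x post} → AllPairs R (pre ++ x ∷ post) →
                   All (λ y → R y x) pre × All (R x) post × AllPairs R post
  AllPairs-++-∷⁻ []        (Rx ∷ Rpost) = [] , Rx , Rpost
  AllPairs-++-∷⁻ (y ∷ pre) (Ry ∷ Rrest) with AllPairs-++-∷⁻ pre Rrest
  ... | Rpre , Rx , Rpost = All.head (All.++⁻ʳ pre Ry) ∷ Rpre , Rx , Rpost

allFin-split : ∀ {n} (i : Fin n) → ∃₂ λ pre post →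
               allFin n ≡ pre ++ i ∷ post × All (_< i) pre × All (i <_) post × Unique post
allFin-split {n} i with ∈-∃++ (∈-allFin i)
... | pre , post , allFin≡ with AllPairs-++-∷⁻ pre (subst (AllPairs _<_) allFin≡ (AllPairs.tabulate⁺-< (λ p → p)))
...   | pre<i , i<post , post-sorted = pre , post , allFin≡ , pre<i , i<post , AllPairs.map <⇒≢ post-sorted

module _ {n : ℕ} (f : Fin n → Fin n) where

  sweep : List (Fin n) → Fin n → Fin n
  sweep []      x = x
  sweep (k ∷ L) x = sweep L (PC.transpose k (f k) x)

  foldr-transpose-⟨$⟩ʳ : ∀ L x → foldr (λ k π → transpose k (f k) ∘ₚ π) id L ⟨$⟩ʳ x ≡ sweep L x
  foldr-transpose-⟨$⟩ʳ []      x = refl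
  foldr-transpose-⟨$⟩ʳ (k ∷ L) x = foldr-transpose-⟨$⟩ʳ L (PC.transpose k (f k) x)

  sweep-++ : ∀ L M x → sweep (L ++ M) x ≡ sweep M (sweep L x)
  sweep-++ []      M x = refl
  sweep-++ (k ∷ L) M x = sweep-++ L M _

  sweep-fixes : ∀ {L x} → All (λ k → x ≢ k × x ≢ f k) L → sweep L x ≡ x
  sweep-fixes {[]}    []                  = refl
  sweep-fixes {k ∷ L} ((x≢k , x≢fk) ∷ ps) = trans (cong (sweep L) (transpose-≢ x≢k x≢fk)) (sweep-fixes ps)

  sweep-∈ : ∀ {L y} → Unique L → All (y ≢_) L → sweep L y ∈ y ∷ L
  sweep-∈ {[]}    []          []          = here refl
  sweep-∈ {k ∷ L} {y} (k∉L ∷ L!) (y≢k ∷ y∉L) with y ≟ f k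
  ... | yes refl rewrite transpose-right y≢k = there (sweep-∈ L! k∉L)
  ... | no y≢fk rewrite transpose-≢ y≢k y≢fk with sweep-∈ L! y∉L
  ...   | here eq = here eq
  ...   | there m = there (there m)

  sweep-hit-∈ : ∀ {L x} → Unique L → All (x ≢_) L → Any (λ k → f k ≡ x) L → sweep L x ∈ L
  sweep-hit-∈ {k ∷ L} {x} (k∉L ∷ L!) (x≢k ∷ x∉L) hit with x ≟ f k | hit
  ... | yes refl | _       rewrite transpose-right x≢k = sweep-∈ L! k∉L
  ... | no x≢fk  | here eq = contradiction (sym eq) x≢fk
  ... | no x≢fk  | there h rewrite transpose-≢ x≢k x≢fk = there (sweep-hit-∈ L! x∉L h)

module _ {n : ℕ} {f : Fin n → Fin n} (sub : Subexceedant f) {i : Fin n} where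

  f≢-above : ∀ {k} → i < k → f i ≢ k
  f≢-above i<k = <⇒≢ (≤-<-trans (sub i) i<k)

  AX-if-fixed : f i ≡ φ f ⟨$⟩ʳ i → AX (φ f) i
  AX-if-fixed fi≡σi = subst (λ z → toℕ z ≤ toℕ i) fi≡σi (sub i)

  module AtSplit {pre post : List (Fin n)} (allFin≡ : allFin n ≡ pre ++ i ∷ post)
           (pre<i : All (_< i) pre) (i<post : All (i <_) post) (post! : Unique post) where

    φ-⟨$⟩ʳ-split : φ f ⟨$⟩ʳ i ≡ sweep f post (f i)
    φ-⟨$⟩ʳ-split = begin
      φ f ⟨$⟩ʳ i                            ≡⟨ foldr-transpose-⟨$⟩ʳ f (allFin n) i ⟩
      sweep f (allFin n) i                  ≡⟨ cong (λ L → sweep f L i) allFin≡ ⟩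
      sweep f (pre ++ i ∷ post) i           ≡⟨ sweep-++ f pre (i ∷ post) i ⟩
      sweep f (i ∷ post) (sweep f pre i)    ≡⟨ cong (sweep f (i ∷ post)) (sweep-fixes f (All.map i∉pre pre<i)) ⟩
      sweep f post (PC.transpose i (f i) i) ≡⟨ cong (sweep f post) (transpose-left {i = i}) ⟩
      sweep f post (f i)                    ∎
      where
      open ≡-Reasoning
      i∉pre : ∀ {k} → k < i → i ≢ k × i ≢ f k
      i∉pre k<i = <⇒≢ k<i ∘ sym , <⇒≢ (≤-<-trans (sub _) k<i) ∘ sym

    fixed-if-ImRp : ImRp f i → f i ≡ φ f ⟨$⟩ʳ i
    fixed-if-ImRp imp = sym (trans φ-⟨$⟩ʳ-split (sweep-fixes f (All.map unhit i<post)))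
      where
      unhit : ∀ {k} → i < k → f i ≢ k × f i ≢ f k
      unhit i<k = f≢-above i<k , (λ fi≡fk → imp _ i<k (sym fi≡fk))

    ImRp-if-AX : AX (φ f) i → ImRp f i
    ImRp-if-AX ax k i<k fk≡fi = <⇒≱ (All.lookup i<post σi∈post) ax
      where
      k∈post : k ∈ post
      k∈post with ∈-++⁻ pre (subst (k ∈_) allFin≡ (∈-allFin k))
      ... | inj₁ k∈pre         = contradiction (All.lookup pre<i k∈pre) (<-asym i<k)
      ... | inj₂ (here refl)   = contradiction refl (<⇒≢ i<k)
      ... | inj₂ (there k∈post) = k∈post
      σi∈post : φ f ⟨$⟩ʳ i ∈ post
      σi∈post = subst (_∈ post) (sym φ-⟨$⟩ʳ-split)
        (sweep-hit-∈ f post! (All.map f≢-above i<post) (lose k∈post fk≡fi))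

proposition3p1 : ∀ (n : ℕ) (f : Fin n → Fin n) → Subexceedant f → (i : Fin n) →
    (ImRp f i ⇔ AX (φ f) i) × ((f i ≡ φ f ⟨$⟩ʳ i) ⇔ AX (φ f) i)
proposition3p1 n f sub i with allFin-split i
... | pre , post , allFin≡ , pre<i , i<post , post! =
  mk⇔ (AX-if-fixed sub ∘ fixed-if-ImRp) ImRp-if-AX , mk⇔ (AX-if-fixed sub) (fixed-if-ImRp ∘ ImRp-if-AX)
  where open AtSplit sub allFin≡ pre<i i<post post!
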